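{- For every integer $n\ge 0$ we have $(n^2+2n)/3 \leq m(n) \leq n^2$.
   Context: For $n\ge 0$, $m(n)$ denotes the integer obtained by reading the base-$2$ representation of $n$ as a base-$4$ numeral; i.e., if $n=\sum_i c_i 2^i$ with $c_i\in\{0,1\}$, then $m(n)=\sum_i c_i 4^i$. -}

module Defs where

open import Data.Nat using (ℕ; zero; suc; _+_; _*_)
open import Data.Nat.DivMod using (_/_; _%_)

-- Auxiliary: digit-by-digit conversion with fuel.  With fuel k ≥ number of
-- binary digits of n (fuel n suffices), mAux k n = Σ cᵢ 4^i where n = Σ cᵢ 2^i.
mAux : ℕ → ℕ → ℕ
mAux zero    n = 0
mAux (suc k) n = n % 2 + 4 * mAux k (n / 2)

-- m(n): the base-2 representation of n read as a base-4 numeral.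
m : ℕ → ℕ
m n = mAux n n

{-# OPTIONS --safe #-}
module Submission where

open import Defs
open import Data.List using (_∷_; [])
open import Data.Nat using (ℕ; zero; suc; _+_; _*_; _≤_; _<_; z≤n; s≤s; s≤s⁻¹)
open import Data.Nat.DivMod using (_/_; _%_; m≡m%n+[m/n]*n; m%n<n; m/n<m; /-monoˡ-≤)
open import Data.Nat.Properties
open import Data.Nat.Tactic.RingSolver using (solve)
open import Data.Product using (_×_; _,_)
open import Relation.Binary.PropositionalEquality using (_≡_; sym; subst)

-- Induction on the binary digits: writing n = 2q + r with r ∈ {0, 1} gives
-- m(n) = 4 m(q) + r, and the bounds for q, multiplied by 4 with r added, yield those
-- for n, since (2q + r)² = 4q² + 4rq + r and (2q + r)² + 2(2q + r) = 4(q² + 2q) + 3r − 4q(1 − r).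

record Sandwiched (n M : ℕ) : Set where
  constructor sandwiched
  field
    lower : n * n + 2 * n ≤ 3 * M
    upper : M ≤ n * n

sandwiched-double : ∀ {q M} → Sandwiched q M → Sandwiched (2 * q) (4 * M)
sandwiched-double {q} {M} (sandwiched lower upper) = sandwiched lower′ upper′
  where
  open ≤-Reasoning
  lower′ : 2 * q * (2 * q) + 2 * (2 * q) ≤ 3 * (4 * M)
  lower′ = begin
    2 * q * (2 * q) + 2 * (2 * q)          ≤⟨ m≤m+n _ (4 * q) ⟩
    2 * q * (2 * q) + 2 * (2 * q) + 4 * q  ≡⟨ solve (q ∷ []) ⟩
    4 * (q * q + 2 * q)                    ≤⟨ *-monoʳ-≤ 4 lower ⟩
    4 * (3 * M)                            ≡⟨ solve (M ∷ []) ⟩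
    3 * (4 * M)                            ∎
  upper′ : 4 * M ≤ 2 * q * (2 * q)
  upper′ = begin
    4 * M            ≤⟨ *-monoʳ-≤ 4 upper ⟩
    4 * (q * q)      ≡⟨ solve (q ∷ []) ⟩
    2 * q * (2 * q)  ∎

sandwiched-double+1 : ∀ {q M} → Sandwiched q M → Sandwiched (1 + 2 * q) (1 + 4 * M)
sandwiched-double+1 {q} {M} (sandwiched lower upper) = sandwiched lower′ upper′
  where
  open ≤-Reasoning
  lower′ : (1 + 2 * q) * (1 + 2 * q) + 2 * (1 + 2 * q) ≤ 3 * (1 + 4 * M)
  lower′ = begin
    (1 + 2 * q) * (1 + 2 * q) + 2 * (1 + 2 * q)  ≡⟨ solve (q ∷ []) ⟩
    4 * (q * q + 2 * q) + 3                      ≤⟨ +-monoˡ-≤ 3 (*-monoʳ-≤ 4 lower) ⟩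
    4 * (3 * M) + 3                              ≡⟨ solve (M ∷ []) ⟩
    3 * (1 + 4 * M)                              ∎
  upper′ : 1 + 4 * M ≤ (1 + 2 * q) * (1 + 2 * q)
  upper′ = begin
    1 + 4 * M                  ≤⟨ +-monoʳ-≤ 1 (*-monoʳ-≤ 4 upper) ⟩
    1 + 4 * (q * q)            ≤⟨ m≤m+n _ (4 * q) ⟩
    1 + 4 * (q * q) + 4 * q    ≡⟨ solve (q ∷ []) ⟩
    (1 + 2 * q) * (1 + 2 * q)  ∎

sandwiched-appendDigit : ∀ {r q M} → r < 2 → Sandwiched q M → Sandwiched (r + 2 * q) (r + 4 * M)
sandwiched-appendDigit {zero}        _ = sandwiched-double
sandwiched-appendDigit {suc zero}    _ = sandwiched-double+1
sandwiched-appendDigit {suc (suc _)} (s≤s (s≤s ()))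

n≡n%2+2*[n/2] : ∀ n → n ≡ n % 2 + 2 * (n / 2)
n≡n%2+2*[n/2] n = subst (λ k → n ≡ n % 2 + k) (*-comm (n / 2) 2) (m≡m%n+[m/n]*n n 2)

n≤1+k⇒n/2≤k : ∀ {n k} → n ≤ suc k → n / 2 ≤ k
n≤1+k⇒n/2≤k {k = k} n≤1+k =
  s≤s⁻¹ (≤-<-trans (/-monoˡ-≤ 2 n≤1+k) (m/n<m (suc k) 2 (s≤s (s≤s z≤n))))

-- With fuel k ≥ n the recursion only runs dry at n = 0, and halving preserves k ≥ n.
sandwiched-mAux : ∀ k n → n ≤ k → Sandwiched n (mAux k n)
sandwiched-mAux zero    zero z≤n   = sandwiched z≤n z≤n
sandwiched-mAux (suc k) n    n≤1+k =
  subst (λ n′ → Sandwiched n′ (mAux (suc k) n)) (sym (n≡n%2+2*[n/2] n))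
    (sandwiched-appendDigit (m%n<n n 2) (sandwiched-mAux k (n / 2) (n≤1+k⇒n/2≤k n≤1+k)))

lemma19 : (n : ℕ) → (n * n + 2 * n ≤ 3 * m n) × (m n ≤ n * n)
lemma19 n = lower , upper
  where open Sandwiched (sandwiched-mAux n n ≤-refl)
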